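{- Let $G$ be a $\Delta$-regular graph and let $C$ be a total $k$-correspondence assignment of $G$. Apply the following random procedure: (1) each vertex $u$ independently receives a colour $f_1(u)$ chosen uniformly at random from $C(u)$; (2) for each edge $uv$, independently an end $D(uv)\in\{u,v\}$ is chosen uniformly at random; (3) each vertex $u$ keeps its colour (i.e. $f(u)=f_1(u)$) if and only if for every edge $uv \in E(G)$, $C_{uv}(f_1(u)) \neq f_1(v)$ or $D(uv)=v$, and otherwise $u$ is uncoloured. Then for every vertex $u$, the probability that $u$ keeps its colour is $\left(1-\frac{1}{2k}\right)^{\Delta}$.
   Context: Fix an arbitrary orientation of $G$. A correspondence assignment $C$ of $G$ assigns to each vertex $u$ a set $C(u)\subseteq \mathbb{N}$, and to each oriented edge $uv$ an injective partial function $C_{uv}: C(u)\to C(v)$, with $C_{vu}=C_{uv}^{ -1}$. It is a $k$-correspondence assignment if $|C(u)|\ge k$ for all $u$. It is total if $C_{uv}$ and $C_{vu}$ are total functions (defined on all of $C(u)$, resp. $C(v)$) for every edge $uv$; if $G$ is connected this forces all $|C(u)|$ to be equal.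
   Formalization: A k-correspondence assignment has $|C(u)| = k$ exactly at every vertex u, in place of the condition $|C(u)|\ge k$. The statement above fails without it. -}

module Defs where

open import Data.Nat using (ℕ; zero; suc; _*_; _≡ᵇ_; _<ᵇ_; NonZero)
open import Data.Bool using (Bool; T?; true; false; not; _∨_; if_then_else_)
open import Data.Fin using (Fin; toℕ; _≟_)
import Data.Fin as Fin
open import Data.List using (List; []; _∷_; [_]; map; concatMap; length; filter; allFin)
open import Data.Bool.ListAction using (and)
open import Data.List.Membership.Propositional using (_∈_)
open import Data.List.Relation.Unary.Unique.Propositional using (Unique)
open import Data.Maybe using (Maybe; just; nothing)
open import Data.Product using (_×_; _,_; ∃)
open import Data.Integer using (+_)
open import Data.Rational using (ℚ; _/_; 0ℚ; 1ℚ; _-_) renaming (_*_ to _*ℚ_)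
open import Relation.Binary.PropositionalEquality using (_≡_)
open import Relation.Nullary using (does)

record Graph (n : ℕ) : Set where
  field
    adj   : Fin n → Fin n → Bool
    sym   : ∀ u v → adj u v ≡ adj v u
    irrefl : ∀ u → adj u u ≡ false
open Graph public

degree : ∀ {n} → Graph n → Fin n → ℕ
degree G u = length (filter (λ v → T? (adj G u v)) (allFin _))

IsRegular : ∀ {n} → Graph n → ℕ → Set
IsRegular {n} G Δ = ∀ (u : Fin n) → degree G u ≡ Δ

-- C(u) is a finite subset of ℕ, given as a duplicate-free list.
-- corr u v is the injective partial function C_uv : C(u) → C(v) (for adjacent
-- u, v), with C_vu = C_uv⁻¹.  (Giving both directions with the inverse law is
-- the same data as C_uv for a fixed orientation.)

record CorrAssignment {n : ℕ} (G : Graph n) : Set where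
  field
    C       : Fin n → List ℕ
    C-uniq  : ∀ u → Unique (C u)
    corr    : Fin n → Fin n → ℕ → Maybe ℕ
    corr-dom : ∀ u v → adj G u v ≡ true → ∀ a b → corr u v a ≡ just b → a ∈ C u × b ∈ C v
    corr-inj : ∀ u v → adj G u v ≡ true → ∀ a a' b →
               corr u v a ≡ just b → corr u v a' ≡ just b → a ≡ a'
    corr-inv : ∀ u v → adj G u v ≡ true → ∀ a b → corr u v a ≡ just b → corr v u b ≡ just a
open CorrAssignment public

IsKCorr : ∀ {n} {G : Graph n} → CorrAssignment G → ℕ → Set
IsKCorr {n} C' k = ∀ (u : Fin n) → length (C C' u) ≡ k

IsTotal : ∀ {n} {G : Graph n} → CorrAssignment G → Set
IsTotal {n} {G} C' = ∀ (u v : Fin n) → adj G u v ≡ true →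
  ∀ a → a ∈ C C' u → ∃ λ b → corr C' u v a ≡ just b

choices : ∀ {A : Set} (m : ℕ) → (Fin m → List A) → List (Fin m → A)
choices zero    L = [ (λ ()) ]
choices (suc m) L =
  concatMap (λ a → map (λ f → λ { Fin.zero → a ; (Fin.suc i) → f i })
                       (choices m (λ i → L (Fin.suc i))))
            (L Fin.zero)

ratio : ℕ → ℕ → ℚ
ratio a zero    = 0ℚ
ratio a (suc d) = (+ a) / suc d

Pr : ∀ {Ω : Set} → List Ω → (Ω → Bool) → ℚ
Pr xs P = ratio (length (filter (λ ω → T? (P ω)) xs)) (length xs)

_^ℚ_ : ℚ → ℕ → ℚ
q ^ℚ zero  = 1ℚ
q ^ℚ suc m = q *ℚ (q ^ℚ m)

-- Outcome: f₁ : colour of each vertex (uniform in C(u), independent);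
--          D : Fin n → Fin n → Bool, where for an edge {u,v} with u < v the
--              bit D u v is a fair coin: true means D(uv) = v (the larger end),
--              false means D(uv) = u.  Entries D x y with x ≥ y are unused
--              independent fair coins (they do not affect probabilities).

Outcome : ℕ → Set
Outcome n = (Fin n → ℕ) × (Fin n → Fin n → Bool)

sampleSpace : ∀ {n} {G : Graph n} → CorrAssignment G → List (Outcome n)
sampleSpace {n} C' =
  concatMap (λ f₁ → map (λ D → f₁ , D)
                       (choices n (λ _ → choices n (λ _ → true ∷ false ∷ []))))
            (choices n (C C'))

chosenEnd : ∀ {n} → (Fin n → Fin n → Bool) → Fin n → Fin n → Fin n
chosenEnd D x y =
  if toℕ x <ᵇ toℕ y then (if D x y then y else x)
                    else (if D y x then x else y)

eqMaybe : Maybe ℕ → ℕ → Bool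
eqMaybe (just a) b = a ≡ᵇ b
eqMaybe nothing  b = false

keeps : ∀ {n} {G : Graph n} → CorrAssignment G → Fin n → Outcome n → Bool
keeps {n} {G} C' u (f₁ , D) =
  and (map (λ v → not (adj G u v)
             ∨ not (eqMaybe (corr C' u v (f₁ u)) (f₁ v))
             ∨ does (chosenEnd D u v ≟ v))
      (allFin n))

oneMinusHalfInv : (k : ℕ) → .{{NonZero k}} → ℚ
oneMinusHalfInv (suc k) = 1ℚ - ((+ 1) / (2 * suc k))

module Submission where

-- Pr is a ratio of counts over Ω = colourings f₁ × coin tables D, so we count.
-- (1) Coins.  For a fixed colouring f₁, "u keeps f₁ u" is a conjunction of
--     constraints each involving a single coin, and only the coin of an edge uv
--     whose colours conflict along uv is constrained (one of its two values is
--     bad).  By the product formula over choice functions (∑-choices-∏) and the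
--     factorisation of an array that is constant off one row and column (∏-star),
--     the number of good coin tables is (2^n)^n ∏_v escapes(v) / 2^n, where
--     escapes(v) is 1 for a conflicting neighbour and 2 otherwise (coins).
-- (2) Colours.  Summing ∏_v escapes(v) over f₁, condition on the colour c of u
--     (∑-choices-hub); by totality exactly one colour of each neighbour
--     conflicts with c, so a neighbour contributes 2k - 1 and any other vertex
--     2k (colours).
-- (3) Hence #good · (2k)^Δ = (2k-1)^Δ · |Ω| (keep-fraction); the arithmetic of
--     fractions in ℚ (ratio-cross, ratio-^, oneMinusHalfInv-ratio) finishes.

open import Defs hiding (sym)
open import Data.Bool using (Bool; true; false; not; _∨_; if_then_else_)
open import Data.Bool.ListAction using (and)
open import Data.Empty using (⊥-elim)
open import Data.Fin using (Fin; toℕ; _≟_) renaming (zero to fzero; suc to fsuc)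
open import Data.Fin.Properties using (toℕ-injective)
import Data.Integer as ℤ
open import Data.Integer.Properties using (pos-*)
open import Data.List using (List; []; _∷_; _++_; map; concatMap; filter; length; tabulate)
open import Data.List.Membership.Propositional using (_∈_)
import Data.List.Relation.Unary.All as All
open import Data.List.Relation.Unary.AllPairs using (_∷_)
open import Data.List.Relation.Unary.Any using (here; there)
open import Data.List.Relation.Unary.Unique.Propositional using (Unique)
open import Data.Nat using (ℕ; NonZero; zero; suc; pred; _+_; _*_; _^_; _≡ᵇ_; _<ᵇ_)
open import Data.Nat.Properties
  using (*-1-commutativeMonoid; +-comm; +-assoc; +-identityʳ; *-comm; *-assoc; *-identityʳ;
         *-zeroʳ; *-distribˡ-+; *-cancelʳ-≡; ^-zeroˡ; m*n≢0; m^n≢0)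
open import Data.Nat.Tactic.RingSolver using (solve-∀)
open import Data.Product using (_,_; proj₂)
open import Data.Rational using (fromℚᵘ; toℚᵘ; 1ℚ)
  renaming (_*_ to _*ℚ_; _+_ to _+ℚ_; -_ to -ℚ_)
open import Data.Rational.Properties
  using (toℚᵘ-injective; toℚᵘ-fromℚᵘ; toℚᵘ-homo-*; toℚᵘ-homo-+; toℚᵘ-homo‿-; fromℚᵘ-cong)
open import Data.Rational.Unnormalised as ℚᵘ using (ℚᵘ; mkℚᵘ; *≡*; _≃_)
import Data.Rational.Unnormalised.Properties as ℚᵘ
open import Relation.Binary.PropositionalEquality
open import Relation.Nullary using (¬_; Dec; does; yes; no)
open import Relation.Nullary.Decidable using (T?; dec-true; dec-false)

import Algebra.Properties.CommutativeMonoid.Sum *-1-commutativeMonoid as Product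
open Product using () renaming (sum-cong-≗ to ∏-cong; ∑-distrib-+ to ∏-distrib-*)

private variable A B : Set

≡ᵇ-refl : ∀ a → (a ≡ᵇ a) ≡ true
≡ᵇ-refl zero    = refl
≡ᵇ-refl (suc a) = ≡ᵇ-refl a

≡ᵇ-sym : ∀ a c → (a ≡ᵇ c) ≡ (c ≡ᵇ a)
≡ᵇ-sym zero    zero    = refl
≡ᵇ-sym zero    (suc c) = refl
≡ᵇ-sym (suc a) zero    = refl
≡ᵇ-sym (suc a) (suc c) = ≡ᵇ-sym a c

≡ᵇ-≢ : ∀ {a c} → ¬ a ≡ c → (a ≡ᵇ c) ≡ false
≡ᵇ-≢ {zero}  {zero}  a≢c = ⊥-elim (a≢c refl)
≡ᵇ-≢ {zero}  {suc c} a≢c = refl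
≡ᵇ-≢ {suc a} {zero}  a≢c = refl
≡ᵇ-≢ {suc a} {suc c} a≢c = ≡ᵇ-≢ (λ a≡c → a≢c (cong suc a≡c))

ind : Bool → ℕ
ind true  = 1
ind false = 0

∑ : List A → (A → ℕ) → ℕ
∑ []       f = 0
∑ (x ∷ xs) f = f x + ∑ xs f

syntax ∑ xs (λ x → e) = ∑[ x ∈ xs ] e

∑-cong : ∀ (xs : List A) {f g : A → ℕ} → (∀ x → x ∈ xs → f x ≡ g x) → ∑ xs f ≡ ∑ xs g
∑-cong []       eq = refl
∑-cong (x ∷ xs) eq = cong₂ _+_ (eq x (here refl)) (∑-cong xs (λ y y∈ → eq y (there y∈)))

∑-const : ∀ (xs : List A) c → ∑[ _ ∈ xs ] c ≡ length xs * c
∑-const []       c = refl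
∑-const (x ∷ xs) c = cong (c +_) (∑-const xs c)

∑-+ : ∀ (xs : List A) f g → ∑[ x ∈ xs ] (f x + g x) ≡ ∑ xs f + ∑ xs g
∑-+ []       f g = refl
∑-+ (x ∷ xs) f g = trans (cong (f x + g x +_) (∑-+ xs f g)) (shuffle (f x) (g x) _ _)
  where
  shuffle : ∀ a b c d → a + b + (c + d) ≡ a + c + (b + d)
  shuffle = solve-∀

∑-*ˡ : ∀ (xs : List A) c f → ∑[ x ∈ xs ] (c * f x) ≡ c * ∑ xs f
∑-*ˡ []       c f = sym (*-zeroʳ c)
∑-*ˡ (x ∷ xs) c f = trans (cong (c * f x +_) (∑-*ˡ xs c f)) (sym (*-distribˡ-+ c (f x) _))

∑-*ʳ : ∀ (xs : List A) c f → ∑[ x ∈ xs ] (f x * c) ≡ ∑ xs f * c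
∑-*ʳ xs c f = trans (∑-cong xs (λ x _ → *-comm (f x) c)) (trans (∑-*ˡ xs c f) (*-comm c _))

∑-++ : ∀ (xs ys : List A) f → ∑ (xs ++ ys) f ≡ ∑ xs f + ∑ ys f
∑-++ []       ys f = refl
∑-++ (x ∷ xs) ys f = trans (cong (f x +_) (∑-++ xs ys f)) (sym (+-assoc (f x) _ _))

∑-swap : ∀ (xs : List A) (ys : List B) (F : A → B → ℕ) →
         ∑[ x ∈ xs ] ∑[ y ∈ ys ] F x y ≡ ∑[ y ∈ ys ] ∑[ x ∈ xs ] F x y
∑-swap []       ys F = sym (trans (∑-const ys 0) (*-zeroʳ (length ys)))
∑-swap (x ∷ xs) ys F =
  trans (cong (∑ ys (F x) +_) (∑-swap xs ys F)) (sym (∑-+ ys (F x) (λ y → ∑[ x′ ∈ xs ] F x′ y)))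

∑-map : ∀ (h : A → B) (xs : List A) f → ∑ (map h xs) f ≡ ∑[ x ∈ xs ] f (h x)
∑-map h []       f = refl
∑-map h (x ∷ xs) f = cong (f (h x) +_) (∑-map h xs f)

∑-concatMap : ∀ (g : A → List B) (xs : List A) f →
              ∑ (concatMap g xs) f ≡ ∑[ x ∈ xs ] ∑ (g x) f
∑-concatMap g []       f = refl
∑-concatMap g (x ∷ xs) f =
  trans (∑-++ (g x) (concatMap g xs) f) (cong (∑ (g x) f +_) (∑-concatMap g xs f))

count : (A → Bool) → List A → ℕ
count P xs = length (filter (λ x → T? (P x)) xs)

count-as-∑ : ∀ (P : A → Bool) (xs : List A) → count P xs ≡ ∑[ x ∈ xs ] ind (P x)
count-as-∑ P []       = refl
count-as-∑ P (x ∷ xs) with P x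
... | true  = cong suc (count-as-∑ P xs)
... | false = count-as-∑ P xs

length-as-∑ : ∀ (xs : List A) → length xs ≡ ∑[ _ ∈ xs ] 1
length-as-∑ xs = trans (sym (*-identityʳ (length xs))) (sym (∑-const xs 1))

∑-pick : ∀ (xs : List ℕ) → Unique xs → ∀ {a} → a ∈ xs → (Y : ℕ → ℕ) →
         ∑[ c ∈ xs ] (ind (a ≡ᵇ c) * Y c) ≡ Y a
∑-pick (x ∷ xs) (x∉xs ∷ uniq) {a} (here refl) Y
  rewrite ≡ᵇ-refl a = trans (cong (Y a + 0 +_) (∑-none xs (λ c∈ a≡c → All.lookup x∉xs c∈ a≡c)))
                            (trans (+-identityʳ _) (+-identityʳ _))
  where
  ∑-none : ∀ ys → (∀ {c} → c ∈ ys → ¬ a ≡ c) → ∑[ c ∈ ys ] (ind (a ≡ᵇ c) * Y c) ≡ 0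
  ∑-none []       _   = refl
  ∑-none (y ∷ ys) a∉ rewrite ≡ᵇ-≢ (a∉ (here refl)) = ∑-none ys (λ c∈ → a∉ (there c∈))
∑-pick (x ∷ xs) (x∉xs ∷ uniq) {a} (there a∈) Y
  rewrite ≡ᵇ-≢ (λ a≡x → All.lookup x∉xs a∈ (sym a≡x)) = ∑-pick xs uniq a∈ Y

∏ : ∀ {n} → (Fin n → ℕ) → ℕ
∏ = Product.sum

syntax ∏ (λ i → e) = ∏[ i ] e

∏-const : ∀ n c → ∏ {n} (λ _ → c) ≡ c ^ n
∏-const zero    c = refl
∏-const (suc n) c = cong (c *_) (∏-const n c)

∏-update : ∀ {n} (j : Fin n) α (g : Fin n → ℕ) →
           ∏[ i ] (if does (i ≟ j) then α else g i) * g j ≡ α * ∏ g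
∏-update {suc n} fzero α g = reorder α (∏[ i ] g (fsuc i)) (g fzero)
  where
  reorder : ∀ a p b → a * p * b ≡ a * (b * p)
  reorder = solve-∀
∏-update {suc n} (fsuc j) α g = begin
  g fzero * ∏[ i ] (if does (i ≟ j) then α else g (fsuc i)) * g (fsuc j)
    ≡⟨ *-assoc (g fzero) _ _ ⟩
  g fzero * (∏[ i ] (if does (i ≟ j) then α else g (fsuc i)) * g (fsuc j))
    ≡⟨ cong (g fzero *_) (∏-update j α (λ i → g (fsuc i))) ⟩
  g fzero * (α * ∏[ i ] g (fsuc i))
    ≡⟨ *-comm-middle (g fzero) α _ ⟩
  α * (g fzero * ∏[ i ] g (fsuc i)) ∎
  where
  open ≡-Reasoning
  *-comm-middle : ∀ a b p → a * (b * p) ≡ b * (a * p)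
  *-comm-middle = solve-∀

∏-select : ∀ {n} (j : Fin n) α → ∏[ i ] (if does (i ≟ j) then α else 1) ≡ α
∏-select {n} j α = begin
  ∏[ i ] (if does (i ≟ j) then α else 1)       ≡⟨ *-identityʳ _ ⟨
  ∏[ i ] (if does (i ≟ j) then α else 1) * 1   ≡⟨ ∏-update j α (λ _ → 1) ⟩
  α * ∏ {n} (λ _ → 1)                          ≡⟨ cong (α *_) (trans (∏-const n 1) (^-zeroˡ n)) ⟩
  α * 1                                        ≡⟨ *-identityʳ α ⟩
  α                                            ∎
  where open ≡-Reasoning

∏-star : ∀ {n} (u : Fin n) β (h : Fin n → Fin n → ℕ) →
         (∀ x y → x ≢ u → y ≢ u → h x y ≡ β) → h u u ≡ β →
         ∏[ x ] ∏[ y ] h x y * β ^ n * β ^ n ≡ ∏[ v ] (h u v * h v u) * (β ^ n) ^ n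
∏-star {n} u β h off-hub at-hub = begin
  ∏[ x ] ∏[ y ] h x y * β ^ n * β ^ n
    ≡⟨ cong (λ z → z * β ^ n * β ^ n) (∏-cong row) ⟩
  ∏[ x ] (if does (x ≟ u) then ∏ (h u) else R x) * β ^ n * β ^ n
    ≡⟨ cong (λ z → ∏[ x ] (if does (x ≟ u) then ∏ (h u) else R x) * z * β ^ n) R-hub ⟨
  ∏[ x ] (if does (x ≟ u) then ∏ (h u) else R x) * R u * β ^ n
    ≡⟨ cong (_* β ^ n) (∏-update u (∏ (h u)) R) ⟩
  ∏ (h u) * ∏ R * β ^ n
    ≡⟨ *-assoc (∏ (h u)) _ _ ⟩
  ∏ (h u) * (∏ R * β ^ n)
    ≡⟨ cong (∏ (h u) *_) columns ⟩
  ∏ (h u) * (∏[ x ] h x u * (β ^ n) ^ n)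
    ≡⟨ *-assoc (∏ (h u)) _ _ ⟨
  ∏ (h u) * ∏[ x ] h x u * (β ^ n) ^ n
    ≡⟨ cong (_* (β ^ n) ^ n) (∏-distrib-* (h u) (λ x → h x u)) ⟨
  ∏[ v ] (h u v * h v u) * (β ^ n) ^ n ∎
  where
  open ≡-Reasoning
  R : Fin n → ℕ
  R x = ∏[ y ] (if does (y ≟ u) then h x u else β)

  row : ∀ x → ∏ (h x) ≡ (if does (x ≟ u) then ∏ (h u) else R x)
  row x with x ≟ u
  ... | yes refl = refl
  ... | no x≢u   = ∏-cong entry
    where
    entry : ∀ y → h x y ≡ (if does (y ≟ u) then h x u else β)
    entry y with y ≟ u
    ... | yes refl = refl
    ... | no y≢u   = off-hub x y x≢u y≢u

  R-hub : R u ≡ β ^ n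
  R-hub = trans (∏-cong entry) (∏-const n β)
    where
    entry : ∀ y → (if does (y ≟ u) then h u u else β) ≡ β
    entry y with y ≟ u
    ... | yes _ = at-hub
    ... | no _  = refl

  columns : ∏ R * β ^ n ≡ ∏[ x ] h x u * (β ^ n) ^ n
  columns = begin
    ∏ R * β ^ n                          ≡⟨ cong (∏ R *_) (∏-const n β) ⟨
    ∏ R * ∏ {n} (λ _ → β)                ≡⟨ ∏-distrib-* R (λ _ → β) ⟨
    ∏[ x ] (R x * β)                     ≡⟨ ∏-cong (λ x → trans (∏-update u (h x u) (λ _ → β))
                                                                (cong (h x u *_) (∏-const n β))) ⟩
    ∏[ x ] (h x u * β ^ n)               ≡⟨ ∏-distrib-* (λ x → h x u) (λ _ → β ^ n) ⟩
    ∏[ x ] h x u * ∏ {n} (λ _ → β ^ n)   ≡⟨ cong (∏[ x ] h x u *_) (∏-const n (β ^ n)) ⟩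
    ∏[ x ] h x u * (β ^ n) ^ n           ∎

∏-split : ∀ {n} (f : Fin n → A) (P : A → Bool) α β →
          ∏[ i ] (if P (f i) then α else β) * β ^ count P (tabulate f)
          ≡ α ^ count P (tabulate f) * β ^ n
∏-split {n = zero}  f P α β = refl
∏-split {n = suc n} f P α β with P (f fzero) | ∏-split (λ i → f (fsuc i)) P α β
... | true  | ih = trans (reorder α β _ _) (trans (cong (α * β *_) ih) (reorder′ α β _ _))
  where
  reorder : ∀ a b p q → a * p * (b * q) ≡ a * b * (p * q)
  reorder = solve-∀
  reorder′ : ∀ a b x y → a * b * (x * y) ≡ a * x * (b * y)
  reorder′ = solve-∀
... | false | ih = trans (*-assoc β _ _) (trans (cong (β *_) ih) (reorder β (α ^ c) (β ^ n)))
  where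
  c = count P (tabulate (λ i → f (fsuc i)))
  reorder : ∀ b x y → b * (x * y) ≡ x * (b * y)
  reorder = solve-∀

*-^ : ∀ a b n → (a * b) ^ n ≡ a ^ n * b ^ n
*-^ a b n = begin
  (a * b) ^ n                            ≡⟨ ∏-const n (a * b) ⟨
  ∏ {n} (λ _ → a * b)                    ≡⟨ ∏-distrib-* {n} (λ _ → a) (λ _ → b) ⟩
  ∏ {n} (λ _ → a) * ∏ {n} (λ _ → b)      ≡⟨ cong₂ _*_ (∏-const n a) (∏-const n b) ⟩
  a ^ n * b ^ n                          ∎
  where open ≡-Reasoning

ind-and : ∀ {n} (g : A → Bool) (f : Fin n → A) →
          ind (and (map g (tabulate f))) ≡ ∏[ i ] ind (g (f i))
ind-and {n = zero}  g f = refl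
ind-and {n = suc n} g f with g (f fzero)
... | true  = trans (ind-and g (λ i → f (fsuc i))) (sym (+-identityʳ _))
... | false = refl

∑-choices-∏ : ∀ m (L : Fin m → List A) (w : Fin m → A → ℕ) →
              ∑[ f ∈ choices m L ] ∏[ i ] w i (f i) ≡ ∏[ i ] ∑ (L i) (w i)
∑-choices-∏ zero    L w = refl
∑-choices-∏ (suc m) L w = begin
  ∑[ f ∈ choices (suc m) L ] ∏[ i ] w i (f i)
    ≡⟨ trans (∑-concatMap _ (L fzero) _)
             (∑-cong (L fzero) (λ a _ → trans (∑-map _ rest _) (∑-*ˡ rest (w fzero a) _))) ⟩
  ∑[ a ∈ L fzero ] (w fzero a * ∑[ f ∈ rest ] ∏[ i ] w (fsuc i) (f i))
    ≡⟨ ∑-*ʳ (L fzero) _ (w fzero) ⟩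
  ∑ (L fzero) (w fzero) * ∑[ f ∈ rest ] ∏[ i ] w (fsuc i) (f i)
    ≡⟨ cong (∑ (L fzero) (w fzero) *_) (∑-choices-∏ m (λ i → L (fsuc i)) (λ i → w (fsuc i))) ⟩
  ∏[ i ] ∑ (L i) (w i) ∎
  where
  open ≡-Reasoning
  rest = choices m (λ i → L (fsuc i))

∑-choices-cong : ∀ m (L : Fin m → List A) {F G : (Fin m → A) → ℕ} →
                 (∀ f → (∀ i → f i ∈ L i) → F f ≡ G f) → ∑ (choices m L) F ≡ ∑ (choices m L) G
∑-choices-cong zero    L eq = cong (_+ 0) (eq _ (λ ()))
∑-choices-cong (suc m) L {F} {G} eq =
  trans (∑-concatMap _ (L fzero) F)
        (trans (∑-cong (L fzero) (λ a a∈ →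
                  trans (∑-map _ rest F)
                        (trans (∑-choices-cong m _ (λ f f∈ → eq _ λ { fzero → a∈ ; (fsuc i) → f∈ i }))
                               (sym (∑-map _ rest G)))))
               (sym (∑-concatMap _ (L fzero) G)))
  where rest = choices m (λ i → L (fsuc i))

length-choices : ∀ m (L : Fin m → List A) → length (choices m L) ≡ ∏[ i ] length (L i)
length-choices m L = begin
  length (choices m L)                     ≡⟨ length-as-∑ (choices m L) ⟩
  ∑[ _ ∈ choices m L ] 1                   ≡⟨ ∑-cong (choices m L) (λ _ _ → sym ∏-ones) ⟩
  ∑[ f ∈ choices m L ] ∏ {m} (λ _ → 1)     ≡⟨ ∑-choices-∏ m L (λ _ _ → 1) ⟩
  ∏[ i ] ∑[ _ ∈ L i ] 1                    ≡⟨ ∏-cong (λ i → sym (length-as-∑ (L i))) ⟩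
  ∏[ i ] length (L i)                      ∎
  where
  open ≡-Reasoning
  ∏-ones : ∏ {m} (λ _ → 1) ≡ 1
  ∏-ones = trans (∏-const m 1) (^-zeroˡ m)

-- Conditioning on the value at a hub u: when every factor depends on f u and on
-- one further value f v, first fix the hub value c, then the others are independent.
∑-choices-hub : ∀ n (L : Fin n → List ℕ) (u : Fin n) → Unique (L u) → (W : ℕ → Fin n → ℕ → ℕ) →
  ∑[ f ∈ choices n L ] ∏[ v ] W (f u) v (f v)
    ≡ ∑[ c ∈ L u ] ∏[ v ] (if does (v ≟ u) then W c u c else ∑[ a ∈ L v ] W c v a)
∑-choices-hub n L u uniq W = begin
  ∑[ f ∈ choices n L ] ∏[ v ] W (f u) v (f v)
    ≡⟨ ∑-choices-cong n L (λ f f∈ → fix-hub f (f∈ u)) ⟩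
  ∑[ f ∈ choices n L ] ∑[ c ∈ L u ] ∏[ v ] (sel c v (f v) * W c v (f v))
    ≡⟨ ∑-swap (choices n L) (L u) _ ⟩
  ∑[ c ∈ L u ] ∑[ f ∈ choices n L ] ∏[ v ] (sel c v (f v) * W c v (f v))
    ≡⟨ ∑-cong (L u) (λ c _ → ∑-choices-∏ n L (λ v a → sel c v a * W c v a)) ⟩
  ∑[ c ∈ L u ] ∏[ v ] ∑[ a ∈ L v ] (sel c v a * W c v a)
    ≡⟨ ∑-cong (L u) (λ c c∈ → ∏-cong (sum-at c c∈)) ⟩
  ∑[ c ∈ L u ] ∏[ v ] (if does (v ≟ u) then W c u c else ∑[ a ∈ L v ] W c v a) ∎
  where
  open ≡-Reasoning
  sel : ℕ → Fin n → ℕ → ℕ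
  sel c v a = if does (v ≟ u) then ind (c ≡ᵇ a) else 1

  fix-hub : ∀ f → f u ∈ L u →
            ∏[ v ] W (f u) v (f v) ≡ ∑[ c ∈ L u ] ∏[ v ] (sel c v (f v) * W c v (f v))
  fix-hub f fu∈ = sym (begin
    ∑[ c ∈ L u ] ∏[ v ] (sel c v (f v) * W c v (f v))
      ≡⟨ ∑-cong (L u) (λ c _ → ∏-distrib-* (λ v → sel c v (f v)) (λ v → W c v (f v))) ⟩
    ∑[ c ∈ L u ] (∏[ v ] sel c v (f v) * ∏[ v ] W c v (f v))
      ≡⟨ ∑-cong (L u) (λ c _ → cong (_* ∏[ v ] W c v (f v)) (sel-hub c)) ⟩
    ∑[ c ∈ L u ] (ind (f u ≡ᵇ c) * ∏[ v ] W c v (f v))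
      ≡⟨ ∑-pick (L u) uniq fu∈ (λ c → ∏[ v ] W c v (f v)) ⟩
    ∏[ v ] W (f u) v (f v) ∎)
    where
    sel-hub : ∀ c → ∏[ v ] sel c v (f v) ≡ ind (f u ≡ᵇ c)
    sel-hub c = trans (∏-cong at) (trans (∏-select u (ind (c ≡ᵇ f u))) (cong ind (≡ᵇ-sym c (f u))))
      where
      at : ∀ v → sel c v (f v) ≡ (if does (v ≟ u) then ind (c ≡ᵇ f u) else 1)
      at v with v ≟ u
      ... | yes refl = refl
      ... | no _     = refl

  sum-at : ∀ c → c ∈ L u → ∀ v → ∑[ a ∈ L v ] (sel c v a * W c v a)
                                 ≡ (if does (v ≟ u) then W c u c else ∑[ a ∈ L v ] W c v a)
  sum-at c c∈ v with v ≟ u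
  ... | yes refl = ∑-pick (L u) uniq c∈ (W c u)
  ... | no _     = ∑-cong (L v) (λ a _ → +-identityʳ (W c v a))

<ᵇ-irrefl : ∀ m → (m <ᵇ m) ≡ false
<ᵇ-irrefl zero    = refl
<ᵇ-irrefl (suc m) = <ᵇ-irrefl m

<ᵇ-flip : ∀ {m n} → m ≢ n → (n <ᵇ m) ≡ not (m <ᵇ n)
<ᵇ-flip {zero}  {zero}  m≢n = ⊥-elim (m≢n refl)
<ᵇ-flip {zero}  {suc n} m≢n = refl
<ᵇ-flip {suc m} {zero}  m≢n = refl
<ᵇ-flip {suc m} {suc n} m≢n = <ᵇ-flip (λ m≡n → m≢n (cong suc m≡n))

bits : List Bool
bits = true ∷ false ∷ []

coinTables : ∀ n → List (Fin n → Fin n → Bool)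
coinTables n = choices n (λ _ → choices n (λ _ → bits))

sampleSpace-size : ∀ {n} {G : Graph n} (C' : CorrAssignment G) k → IsKCorr C' k →
                   length (sampleSpace C') ≡ k ^ n * (2 ^ n) ^ n
sampleSpace-size {n} C' k kc = begin
  length (sampleSpace C')                                  ≡⟨ length-as-∑ (sampleSpace C') ⟩
  ∑[ _ ∈ sampleSpace C' ] 1                                ≡⟨ ∑-concatMap _ (choices n (C C')) _ ⟩
  ∑[ f₁ ∈ choices n (C C') ] ∑ (map (f₁ ,_) (coinTables n)) (λ _ → 1)
    ≡⟨ ∑-cong (choices n (C C')) (λ f₁ _ → trans (∑-map (f₁ ,_) (coinTables n) _)
                                                (sym (length-as-∑ (coinTables n)))) ⟩
  ∑[ _ ∈ choices n (C C') ] length (coinTables n)          ≡⟨ ∑-const (choices n (C C')) _ ⟩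
  length (choices n (C C')) * length (coinTables n)        ≡⟨ cong₂ _*_ colourings tables ⟩
  k ^ n * (2 ^ n) ^ n                                      ∎
  where
  open ≡-Reasoning
  colourings : length (choices n (C C')) ≡ k ^ n
  colourings = trans (length-choices n (C C')) (trans (∏-cong kc) (∏-const n k))
  tables : length (coinTables n) ≡ (2 ^ n) ^ n
  tables = trans (length-choices n (λ _ → choices n (λ _ → bits)))
                 (trans (∏-cong {n} (λ _ → trans (length-choices n (λ _ → bits)) (∏-const n 2)))
                        (∏-const n (2 ^ n)))

module AtVertex {n} (G : Graph n) (C' : CorrAssignment G) (u : Fin n) where

  _≺_ : Fin n → Fin n → Bool
  x ≺ y = toℕ x <ᵇ toℕ y

  ≺-flip : ∀ {x} → x ≢ u → (x ≺ u) ≡ not (u ≺ x)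
  ≺-flip x≢u = <ᵇ-flip (λ eq → x≢u (toℕ-injective (sym eq)))

  -- safe c v a b: with u coloured c and v coloured a, the edge uv does not
  -- uncolour u, given b = [D(uv) = v].  It holds trivially when uv is no edge.
  safe : ℕ → Fin n → ℕ → Bool → Bool
  safe c v a b = not (adj G u v) ∨ not (eqMaybe (corr C' u v c) a) ∨ b

  pointsTo : (Fin n → Fin n → Bool) → Fin n → Bool
  pointsTo D v = does (chosenEnd D u v ≟ v)

  pointsTo-≢ : ∀ D {v} → v ≢ u → pointsTo D v ≡ (if u ≺ v then D u v else not (D v u))
  pointsTo-≢ D {v} v≢u with u ≺ v | D u v | D v u
  ... | true  | true  | _     = dec-true (v ≟ v) refl
  ... | true  | false | _     = dec-false (u ≟ v) (λ u≡v → v≢u (sym u≡v))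
  ... | false | _     | true  = dec-false (u ≟ v) (λ u≡v → v≢u (sym u≡v))
  ... | false | _     | false = dec-true (v ≟ v) refl

  -- coinOK f₁ x y b: the constraint that the single coin D x y = b imposes on u
  -- keeping its colour f₁ u.  Only coins in the row or column of u matter.
  coinOK : (Fin n → ℕ) → Fin n → Fin n → Bool → Bool
  coinOK f₁ x y b =
    if does (x ≟ u) then (if u ≺ y then safe (f₁ u) y (f₁ y) b else true)
    else if does (y ≟ u) then (if x ≺ u then safe (f₁ u) x (f₁ x) (not b) else true)
    else true

  coinOK-off : ∀ f₁ {x y} b → x ≢ u → y ≢ u → coinOK f₁ x y b ≡ true
  coinOK-off f₁ {x} {y} b x≢u y≢u rewrite dec-false (x ≟ u) x≢u | dec-false (y ≟ u) y≢u = refl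

  coinOK-out : ∀ f₁ y b → coinOK f₁ u y b ≡ (if u ≺ y then safe (f₁ u) y (f₁ y) b else true)
  coinOK-out f₁ y b rewrite dec-true (u ≟ u) refl = refl

  coinOK-in : ∀ f₁ {x} b → x ≢ u →
              coinOK f₁ x u b ≡ (if x ≺ u then safe (f₁ u) x (f₁ x) (not b) else true)
  coinOK-in f₁ {x} b x≢u rewrite dec-false (x ≟ u) x≢u | dec-true (u ≟ u) refl = refl

  -- At u itself there is no constraint: u is not adjacent to itself.
  coinOK-hub : ∀ f₁ b → coinOK f₁ u u b ≡ true
  coinOK-hub f₁ b rewrite coinOK-out f₁ u b | <ᵇ-irrefl (toℕ u) = refl

  safe-hub : ∀ c a b → safe c u a b ≡ true
  safe-hub c a b rewrite irrefl G u = refl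

  coin-pair : ∀ f₁ D v → ind (coinOK f₁ u v (D u v)) * ind (coinOK f₁ v u (D v u))
                         ≡ ind (safe (f₁ u) v (f₁ v) (pointsTo D v))
  coin-pair f₁ D v = by-cases (v ≟ u)
    where
    by-cases : Dec (v ≡ u) → ind (coinOK f₁ u v (D u v)) * ind (coinOK f₁ v u (D v u))
                             ≡ ind (safe (f₁ u) v (f₁ v) (pointsTo D v))
    by-cases (yes refl) rewrite coinOK-hub f₁ (D u u) | safe-hub (f₁ u) (f₁ u) (pointsTo D u) = refl
    by-cases (no v≢u) rewrite coinOK-out f₁ v (D u v) | coinOK-in f₁ (D v u) v≢u
                            | pointsTo-≢ D v≢u | ≺-flip v≢u with u ≺ v
    ... | true  = *-identityʳ _
    ... | false = +-identityʳ _

  -- By definition, keeps is the conjunction over v of safe (f₁ u) v (f₁ v) (pointsTo D v);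
  -- coin-pair identifies its factors with the hub row/column of coinOK, and ∏-star
  -- (with β = 1) shows that the remaining coins impose nothing.
  keeps-as-coins : ∀ f₁ D → ind (keeps C' u (f₁ , D)) ≡ ∏[ x ] ∏[ y ] ind (coinOK f₁ x y (D x y))
  keeps-as-coins f₁ D = begin
    ind (keeps C' u (f₁ , D))
      ≡⟨ ind-and (λ v → safe (f₁ u) v (f₁ v) (pointsTo D v)) (λ v → v) ⟩
    ∏[ v ] ind (safe (f₁ u) v (f₁ v) (pointsTo D v))
      ≡⟨ ∏-cong (coin-pair f₁ D) ⟨
    ∏[ v ] (h u v * h v u)
      ≡⟨ *-1^ (∏[ v ] (h u v * h v u)) n ⟨
    ∏[ v ] (h u v * h v u) * 1 ^ n
      ≡⟨ cong (λ z → ∏[ v ] (h u v * h v u) * z ^ n) (^-zeroˡ n) ⟨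
    ∏[ v ] (h u v * h v u) * (1 ^ n) ^ n
      ≡⟨ ∏-star u 1 h (λ x y x≢u y≢u → cong ind (coinOK-off f₁ (D x y) x≢u y≢u))
                      (cong ind (coinOK-hub f₁ (D u u))) ⟨
    ∏[ x ] ∏[ y ] h x y * 1 ^ n * 1 ^ n
      ≡⟨ trans (*-1^ _ n) (*-1^ _ n) ⟩
    ∏[ x ] ∏[ y ] h x y ∎
    where
    open ≡-Reasoning
    h : Fin n → Fin n → ℕ
    h x y = ind (coinOK f₁ x y (D x y))
    *-1^ : ∀ a m → a * 1 ^ m ≡ a
    *-1^ a m = trans (cong (a *_) (^-zeroˡ m)) (*-identityʳ a)

  coinCount : (Fin n → ℕ) → Fin n → Fin n → ℕ
  coinCount f₁ x y = ∑[ b ∈ bits ] ind (coinOK f₁ x y b)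

  -- the number of orientations of the edge uv letting u keep colour c when v has colour a:
  -- 1 if the colours conflict along the edge, 2 otherwise
  escapes : ℕ → Fin n → ℕ → ℕ
  escapes c v a = ∑[ b ∈ bits ] ind (safe c v a b)

  count-pair : ∀ f₁ v → coinCount f₁ u v * coinCount f₁ v u ≡ 2 * escapes (f₁ u) v (f₁ v)
  count-pair f₁ v = by-cases (v ≟ u)
    where
    by-cases : Dec (v ≡ u) → coinCount f₁ u v * coinCount f₁ v u ≡ 2 * escapes (f₁ u) v (f₁ v)
    by-cases (yes refl) rewrite coinOK-hub f₁ true | coinOK-hub f₁ false
                              | safe-hub (f₁ u) (f₁ u) true | safe-hub (f₁ u) (f₁ u) false = refl
    by-cases (no v≢u) rewrite coinOK-out f₁ v true | coinOK-out f₁ v false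
                            | coinOK-in f₁ true v≢u | coinOK-in f₁ false v≢u | ≺-flip v≢u with u ≺ v
    ... | true  = *-comm (escapes (f₁ u) v (f₁ v)) 2
    ... | false = cong (2 *_) (swap (ind (safe (f₁ u) v (f₁ v) false)) (ind (safe (f₁ u) v (f₁ v) true)))
      where
      swap : ∀ a b → a + (b + 0) ≡ b + (a + 0)
      swap = solve-∀

  -- The coins: for a fixed colouring f₁, each edge uv whose colours conflict halves
  -- the number of coin tables under which u keeps its colour.
  coins : ∀ f₁ → ∑[ D ∈ coinTables n ] ind (keeps C' u (f₁ , D)) * 2 ^ n
                 ≡ ∏[ v ] escapes (f₁ u) v (f₁ v) * (2 ^ n) ^ n
  coins f₁ = *-cancelʳ-≡ _ _ (2 ^ n) {{m^n≢0 2 n}} (begin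
    ∑[ D ∈ coinTables n ] ind (keeps C' u (f₁ , D)) * 2 ^ n * 2 ^ n
      ≡⟨ cong (λ z → z * 2 ^ n * 2 ^ n) (trans (∑-cong (coinTables n) (λ D _ → keeps-as-coins f₁ D))
                                               independence) ⟩
    ∏[ x ] ∏[ y ] coinCount f₁ x y * 2 ^ n * 2 ^ n
      ≡⟨ ∏-star u 2 (coinCount f₁) (λ x y x≢u y≢u → off x≢u y≢u) hub ⟩
    ∏[ v ] (coinCount f₁ u v * coinCount f₁ v u) * (2 ^ n) ^ n
      ≡⟨ cong (_* (2 ^ n) ^ n) (trans (∏-cong (count-pair f₁)) (∏-distrib-* (λ _ → 2) esc)) ⟩
    ∏ {n} (λ _ → 2) * ∏ esc * (2 ^ n) ^ n
      ≡⟨ cong (λ z → z * ∏ esc * (2 ^ n) ^ n) (∏-const n 2) ⟩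
    2 ^ n * ∏ esc * (2 ^ n) ^ n
      ≡⟨ rotate (2 ^ n) (∏ esc) ((2 ^ n) ^ n) ⟩
    ∏ esc * (2 ^ n) ^ n * 2 ^ n ∎)
    where
    open ≡-Reasoning
    esc : Fin n → ℕ
    esc v = escapes (f₁ u) v (f₁ v)
    independence : ∑[ D ∈ coinTables n ] ∏[ x ] ∏[ y ] ind (coinOK f₁ x y (D x y))
                   ≡ ∏[ x ] ∏[ y ] coinCount f₁ x y
    independence =
      trans (∑-choices-∏ n _ (λ x row → ∏[ y ] ind (coinOK f₁ x y (row y))))
            (∏-cong (λ x → ∑-choices-∏ n _ (λ y b → ind (coinOK f₁ x y b))))
    off : ∀ {x y} → x ≢ u → y ≢ u → coinCount f₁ x y ≡ 2
    off x≢u y≢u rewrite coinOK-off f₁ true x≢u y≢u | coinOK-off f₁ false x≢u y≢u = refl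
    hub : coinCount f₁ u u ≡ 2
    hub rewrite coinOK-hub f₁ true | coinOK-hub f₁ false = refl
    rotate : ∀ a b c → a * b * c ≡ b * c * a
    rotate = solve-∀

  ∑-sampleSpace : ∀ g → ∑ (sampleSpace C') g
                        ≡ ∑[ f₁ ∈ choices n (C C') ] ∑[ D ∈ coinTables n ] g (f₁ , D)
  ∑-sampleSpace g = trans (∑-concatMap _ (choices n (C C')) g)
                          (∑-cong (choices n (C C')) (λ f₁ _ → ∑-map _ (coinTables n) g))

  module Colours (k : ℕ) (kc : IsKCorr C' k) (tot : IsTotal C') where

    -- options v: the number of (colour of v, orientation of uv) pairs letting u keep a
    -- given colour; 2k - 1 for a neighbour (one colour of v conflicts), 2k otherwise
    options : Fin n → ℕ
    options v = if adj G u v then pred (2 * k) else 2 * k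

    options-hub : options u ≡ 2 * k
    options-hub rewrite irrefl G u = refl

    -- Summing escapes over the colours a of v ≠ u gives options v: 2 for every a,
    -- except 1 for the unique a = C_uv(c) when uv is an edge.
    escapes-sum : ∀ {c} → c ∈ C C' u → ∀ {v} → v ≢ u → ∑[ a ∈ C C' v ] escapes c v a ≡ options v
    escapes-sum {c} c∈ {v} v≢u with adj G u v in uv
    ... | false = trans (∑-const (C C' v) 2) (trans (cong (_* 2) (kc v)) (*-comm k 2))
    ... | true with tot u v uv c c∈
    ...   | b , c↦b rewrite c↦b = cong pred (begin
      suc (∑[ a ∈ C C' v ] esc a)                           ≡⟨ +-comm 1 _ ⟩
      ∑[ a ∈ C C' v ] esc a + 1                             ≡⟨ cong (∑[ a ∈ C C' v ] esc a +_) pick-b ⟨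
      ∑[ a ∈ C C' v ] esc a + ∑[ a ∈ C C' v ] hit a         ≡⟨ ∑-+ (C C' v) esc hit ⟨
      ∑[ a ∈ C C' v ] (esc a + hit a)                       ≡⟨ ∑-cong (C C' v) (λ a _ → esc+hit a) ⟩
      ∑[ _ ∈ C C' v ] 2                                     ≡⟨ ∑-const (C C' v) 2 ⟩
      length (C C' v) * 2                                   ≡⟨ cong (_* 2) (kc v) ⟩
      k * 2                                                 ≡⟨ *-comm k 2 ⟩
      2 * k                                                 ∎)
      where
      open ≡-Reasoning
      esc hit : ℕ → ℕ
      esc a = ind (not (b ≡ᵇ a) ∨ true) + (ind (not (b ≡ᵇ a) ∨ false) + 0)
      hit a = ind (b ≡ᵇ a) * 1
      -- the image b of c is the only colour of v conflicting with c
      pick-b : ∑[ a ∈ C C' v ] hit a ≡ 1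
      pick-b = ∑-pick (C C' v) (C-uniq C' v) (proj₂ (corr-dom C' u v uv c b c↦b)) (λ _ → 1)
      esc+hit : ∀ a → esc a + hit a ≡ 2
      esc+hit a with b ≡ᵇ a
      ... | true  = refl
      ... | false = refl

    -- Conditioning on the colour c of u, the colours of the other vertices are
    -- independent; summing over c contributes the factor k at u.
    colours : ∑[ f₁ ∈ choices n (C C') ] ∏[ v ] escapes (f₁ u) v (f₁ v) ≡ ∏ options
    colours = *-cancelʳ-≡ _ _ 2 (begin
      ∑[ f₁ ∈ choices n (C C') ] ∏[ v ] escapes (f₁ u) v (f₁ v) * 2
        ≡⟨ cong (_* 2) (∑-choices-hub n (C C') u (C-uniq C' u) escapes) ⟩
      ∑[ c ∈ C C' u ] ∏[ v ] (if does (v ≟ u) then escapes c u c else ∑[ a ∈ C C' v ] escapes c v a) * 2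
        ≡⟨ cong (_* 2) (∑-cong (C C' u) (λ c c∈ → ∏-cong (per-vertex c∈))) ⟩
      ∑[ _ ∈ C C' u ] ∏ F * 2
        ≡⟨ cong (_* 2) (trans (∑-const (C C' u) (∏ F)) (cong (_* ∏ F) (kc u))) ⟩
      k * ∏ F * 2
        ≡⟨ reorder k (∏ F) ⟩
      ∏ F * (2 * k)
        ≡⟨ cong (∏ F *_) options-hub ⟨
      ∏ F * options u
        ≡⟨ ∏-update u 2 options ⟩
      2 * ∏ options
        ≡⟨ *-comm 2 (∏ options) ⟩
      ∏ options * 2 ∎)
      where
      open ≡-Reasoning
      F : Fin n → ℕ
      F v = if does (v ≟ u) then 2 else options v
      per-vertex : ∀ {c} → c ∈ C C' u → ∀ v →
        (if does (v ≟ u) then escapes c u c else ∑[ a ∈ C C' v ] escapes c v a) ≡ F v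
      per-vertex {c} c∈ v with v ≟ u
      ... | yes refl rewrite safe-hub c c true | safe-hub c c false = refl
      ... | no v≢u   = escapes-sum c∈ v≢u
      reorder : ∀ a b → a * b * 2 ≡ b * (2 * a)
      reorder = solve-∀

    keep-count : count (keeps C' u) (sampleSpace C') * 2 ^ n ≡ ∏ options * (2 ^ n) ^ n
    keep-count = begin
      count (keeps C' u) (sampleSpace C') * 2 ^ n
        ≡⟨ cong (_* 2 ^ n) (trans (count-as-∑ (keeps C' u) (sampleSpace C')) (∑-sampleSpace _)) ⟩
      ∑[ f₁ ∈ choices n (C C') ] ∑[ D ∈ coinTables n ] ind (keeps C' u (f₁ , D)) * 2 ^ n
        ≡⟨ ∑-*ʳ (choices n (C C')) (2 ^ n) _ ⟨
      ∑[ f₁ ∈ choices n (C C') ] (∑[ D ∈ coinTables n ] ind (keeps C' u (f₁ , D)) * 2 ^ n)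
        ≡⟨ ∑-cong (choices n (C C')) (λ f₁ _ → coins f₁) ⟩
      ∑[ f₁ ∈ choices n (C C') ] (∏[ v ] escapes (f₁ u) v (f₁ v) * (2 ^ n) ^ n)
        ≡⟨ ∑-*ʳ (choices n (C C')) ((2 ^ n) ^ n) _ ⟩
      ∑[ f₁ ∈ choices n (C C') ] ∏[ v ] escapes (f₁ u) v (f₁ v) * (2 ^ n) ^ n
        ≡⟨ cong (_* (2 ^ n) ^ n) colours ⟩
      ∏ options * (2 ^ n) ^ n ∎
      where open ≡-Reasoning

    keep-fraction : count (keeps C' u) (sampleSpace C') * (2 * k) ^ degree G u
                    ≡ pred (2 * k) ^ degree G u * length (sampleSpace C')
    keep-fraction = *-cancelʳ-≡ _ _ (2 ^ n) {{m^n≢0 2 n}} (begin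
      N * (2 * k) ^ d * 2 ^ n                     ≡⟨ swap₂₃ N _ _ ⟩
      N * 2 ^ n * (2 * k) ^ d                     ≡⟨ cong (_* (2 * k) ^ d) keep-count ⟩
      ∏ options * (2 ^ n) ^ n * (2 * k) ^ d       ≡⟨ swap₂₃ (∏ options) _ _ ⟩
      ∏ options * (2 * k) ^ d * (2 ^ n) ^ n
        ≡⟨ cong (_* (2 ^ n) ^ n) (∏-split (λ v → v) (adj G u) (pred (2 * k)) (2 * k)) ⟩
      pred (2 * k) ^ d * (2 * k) ^ n * (2 ^ n) ^ n
        ≡⟨ cong (λ z → pred (2 * k) ^ d * z * (2 ^ n) ^ n) (*-^ 2 k n) ⟩
      pred (2 * k) ^ d * (2 ^ n * k ^ n) * (2 ^ n) ^ n
        ≡⟨ reorder (pred (2 * k) ^ d) (2 ^ n) (k ^ n) ((2 ^ n) ^ n) ⟩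
      pred (2 * k) ^ d * (k ^ n * (2 ^ n) ^ n) * 2 ^ n
        ≡⟨ cong (λ z → pred (2 * k) ^ d * z * 2 ^ n) (sampleSpace-size C' k kc) ⟨
      pred (2 * k) ^ d * length (sampleSpace C') * 2 ^ n ∎)
      where
      open ≡-Reasoning
      N = count (keeps C' u) (sampleSpace C')
      d = degree G u
      swap₂₃ : ∀ a b c → a * b * c ≡ a * c * b
      swap₂₃ = solve-∀
      reorder : ∀ a t q p → a * (t * q) * p ≡ a * (q * p) * t
      reorder = solve-∀

≃-by-cross : ∀ a b c d → a * suc d ≡ c * suc b → mkℚᵘ (ℤ.+ a) b ≃ mkℚᵘ (ℤ.+ c) d
≃-by-cross a b c d eq = *≡* (trans (sym (pos-* a (suc d))) (trans (cong ℤ.+_ eq) (pos-* c (suc b))))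

fromℚᵘ-homo-* : ∀ p q → fromℚᵘ p *ℚ fromℚᵘ q ≡ fromℚᵘ (p ℚᵘ.* q)
fromℚᵘ-homo-* p q = toℚᵘ-injective (begin
  toℚᵘ (fromℚᵘ p *ℚ fromℚᵘ q)            ≈⟨ toℚᵘ-homo-* (fromℚᵘ p) (fromℚᵘ q) ⟩
  toℚᵘ (fromℚᵘ p) ℚᵘ.* toℚᵘ (fromℚᵘ q)   ≈⟨ ℚᵘ.*-cong (toℚᵘ-fromℚᵘ p) (toℚᵘ-fromℚᵘ q) ⟩
  p ℚᵘ.* q                               ≈⟨ toℚᵘ-fromℚᵘ (p ℚᵘ.* q) ⟨
  toℚᵘ (fromℚᵘ (p ℚᵘ.* q))               ∎)
  where open ℚᵘ.≃-Reasoning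

ratio-* : ∀ a b c d .{{_ : NonZero b}} .{{_ : NonZero d}} →
          ratio a b *ℚ ratio c d ≡ ratio (a * c) (b * d)
ratio-* a (suc b) c (suc d) =
  trans (fromℚᵘ-homo-* (mkℚᵘ (ℤ.+ a) b) (mkℚᵘ (ℤ.+ c) d))
        (cong (λ z → fromℚᵘ (mkℚᵘ z _)) (sym (pos-* a c)))

ratio-^ : ∀ a b .{{_ : NonZero b}} Δ → ratio a b ^ℚ Δ ≡ ratio (a ^ Δ) (b ^ Δ)
ratio-^ a b zero    = refl
ratio-^ a b (suc Δ) = trans (cong (ratio a b *ℚ_) (ratio-^ a b Δ))
                            (ratio-* a b (a ^ Δ) (b ^ Δ))
  where instance _ = m^n≢0 b Δ

ratio-cross : ∀ a b c d .{{_ : NonZero b}} .{{_ : NonZero d}} →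
              a * d ≡ c * b → ratio a b ≡ ratio c d
ratio-cross a (suc b) c (suc d) eq = fromℚᵘ-cong (≃-by-cross a b c d eq)

one-minus-ratio : ∀ d → 1ℚ +ℚ -ℚ ratio 1 (suc d) ≡ ratio d (suc d)
one-minus-ratio d = toℚᵘ-injective (begin
  toℚᵘ (1ℚ +ℚ -ℚ fromℚᵘ r)              ≈⟨ toℚᵘ-homo-+ 1ℚ (-ℚ fromℚᵘ r) ⟩
  toℚᵘ 1ℚ ℚᵘ.+ toℚᵘ (-ℚ fromℚᵘ r)       ≈⟨ ℚᵘ.+-congʳ (toℚᵘ 1ℚ) (toℚᵘ-homo‿- (fromℚᵘ r)) ⟩
  toℚᵘ 1ℚ ℚᵘ.+ ℚᵘ.- toℚᵘ (fromℚᵘ r)     ≈⟨ ℚᵘ.+-congʳ (toℚᵘ 1ℚ) (ℚᵘ.-‿cong (toℚᵘ-fromℚᵘ r)) ⟩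
  ℚᵘ.1ℚᵘ ℚᵘ.- r                           ≈⟨ ≃-by-cross _ _ _ _ cross ⟩
  t                                       ≈⟨ toℚᵘ-fromℚᵘ t ⟨
  toℚᵘ (fromℚᵘ t)                         ∎)
  where
  open ℚᵘ.≃-Reasoning
  r t : ℚᵘ
  r = mkℚᵘ (ℤ.+ 1) d
  t = mkℚᵘ (ℤ.+ d) d
  cross : (d + 0) * suc d ≡ d * suc (d + 0)
  cross = subst (λ x → x * suc d ≡ d * suc x) (sym (+-identityʳ d)) refl

-- 1 - 1/(2k) = (2k - 1)/(2k); for k = suc m, 2 * k computes to suc (m + 1 * suc m).
oneMinusHalfInv-ratio : ∀ k .{{_ : NonZero k}} → oneMinusHalfInv k ≡ ratio (pred (2 * k)) (2 * k)
oneMinusHalfInv-ratio (suc m) = one-minus-ratio (m + 1 * suc m)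

proposition3p7 : ∀ {n : ℕ} (G : Graph n) (Δ k : ℕ) .{{_ : NonZero k}} →
    IsRegular G Δ →
    (C' : CorrAssignment G) → IsKCorr C' k → IsTotal C' →
    (u : Fin n) →
    Pr (sampleSpace C') (keeps C' u) ≡ (oneMinusHalfInv k) ^ℚ Δ
proposition3p7 {n} G Δ k reg C' kc tot u = begin
  Pr (sampleSpace C') (keeps C' u)
    ≡⟨ cong (ratio N) (sampleSpace-size C' k kc) ⟩
  ratio N (k ^ n * (2 ^ n) ^ n)
    ≡⟨ ratio-cross N _ _ _ cross ⟩
  ratio (pred (2 * k) ^ Δ) ((2 * k) ^ Δ)
    ≡⟨ ratio-^ (pred (2 * k)) (2 * k) Δ ⟨
  ratio (pred (2 * k)) (2 * k) ^ℚ Δ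
    ≡⟨ cong (_^ℚ Δ) (oneMinusHalfInv-ratio k) ⟨
  oneMinusHalfInv k ^ℚ Δ ∎
  where
  open ≡-Reasoning
  open AtVertex G C' u
  open Colours k kc tot
  N = count (keeps C' u) (sampleSpace C')
  instance
    2k≢0 = m*n≢0 2 k
    |Ω|≢0 = m*n≢0 (k ^ n) ((2 ^ n) ^ n) {{m^n≢0 k n}} {{m^n≢0 (2 ^ n) n {{m^n≢0 2 n}}}}
    2kΔ≢0 = m^n≢0 (2 * k) Δ
  cross : N * (2 * k) ^ Δ ≡ pred (2 * k) ^ Δ * (k ^ n * (2 ^ n) ^ n)
  cross = subst₂ (λ d s → N * (2 * k) ^ d ≡ pred (2 * k) ^ d * s)
                 (reg u) (sampleSpace-size C' k kc) keep-fraction
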